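{- Let $H$ be a connected graph that is edge-maximal with respect to an $r$-rooted tree decomposition $\mathcal{T}=(B_x:x\in V(T))$ of $H$, and let $L_0,\ldots,L_m$ be a BFS layering of $H$ with $L_0=B_r$. Then for any $v,w\in V(H)$, $v\prec_{\mathcal{T}}w$ implies $v\preceq_{\mathcal{L}}w$. Equivalently, there is no pair $v,w\in V(H)$ with $v\prec_{\mathcal{L}}w$ and $w\prec_{\mathcal{T}}v$.
   Context: A tree decomposition $(B_x:x\in V(T))$ of $H$ consists of bags $B_x\subseteq V(H)$ indexed by nodes of a tree $T$ such that for each vertex the nodes whose bags contain it induce a connected subtree, and each edge lies in some bag; it is $r$-rooted if $T$ is rooted at node $r$. $H$ is edge-maximal with respect to it if every bag induces a clique. For $v\in V(H)$, $x_T(v)$ is the minimum-depth node of $T$ whose bag contains $v$; $v\prec_{\mathcal{T}}w$ means $x_T(v)$ is a strict ancestor of $x_T(w)$ in $T$. A BFS layering of a connected graph $H$ is a partition $\mathcal{L}=(L_0,\ldots,L_m)$ of $V(H)$ such that for each $i\ge 1$ and $v\in L_i$, $d_H(v,L_0)=i$ (distance to the nearest vertex of $L_0$). For $v\in L_i$, $w\in L_j$: $v\prec_{\mathcal{L}}w$ iff $i<j$, and $v\preceq_{\mathcal{L}}w$ iff $i\le j$. -}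

module Defs where

open import Data.Nat using (ℕ; zero; suc; _≤_; _<_)
open import Data.Fin using (Fin)
open import Data.Product using (Σ; _×_; ∃; ∃-syntax; _,_)
open import Data.Sum using (_⊎_)
open import Relation.Nullary using (¬_)
open import Relation.Binary.PropositionalEquality using (_≡_; _≢_)

iter : {A : Set} → (A → A) → ℕ → A → A
iter f zero    a = a
iter f (suc j) a = f (iter f j a)

data Walk {A : Set} (R : A → A → Set) : ℕ → A → A → Set where
  nil  : ∀ {a} → Walk R zero a a
  cons : ∀ {k a b c} → R a b → Walk R k b c → Walk R (suc k) a c

Restrict : {A : Set} → (A → A → Set) → (A → Set) → A → A → Set
Restrict R P a b = R a b × P a × P b

record Graph (n : ℕ) : Set₁ where
  field
    Adj   : Fin n → Fin n → Set
    sym   : ∀ {u v} → Adj u v → Adj v u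
    irrefl : ∀ {u} → ¬ Adj u u

open Graph public

Connected : ∀ {n} → Graph n → Set
Connected H = ∀ u v → ∃[ k ] Walk (Adj H) k u v

DistTo : ∀ {n} → Graph n → (Fin n → Set) → Fin n → ℕ → Set
DistTo H S v i =
  (∃[ u ] (S u × Walk (Adj H) i u v)) ×
  (∀ j u → S u → Walk (Adj H) j u v → i ≤ j)

-- Rooted trees on node set Fin k, given by a parent function:
-- parent root = root, and every node reaches the root by iterating parent.
-- Tree edges are {x, parent x} for x ≠ root.

record RootedTree (k : ℕ) : Set where
  field
    root       : Fin k
    parent     : Fin k → Fin k
    parent-root : parent root ≡ root
    reach-root : ∀ x → ∃[ j ] iter parent j x ≡ root

open RootedTree public

TAdj : ∀ {k} → RootedTree k → Fin k → Fin k → Set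
TAdj T x y = (x ≢ root T × parent T x ≡ y) ⊎ (y ≢ root T × parent T y ≡ x)

Depth : ∀ {k} → RootedTree k → Fin k → ℕ → Set
Depth T x d = iter (parent T) d x ≡ root T × (∀ d' → d' < d → iter (parent T) d' x ≢ root T)

StrictAncestor : ∀ {k} → RootedTree k → Fin k → Fin k → Set
StrictAncestor T x y = x ≢ y × ∃[ j ] iter (parent T) j y ≡ x

record TreeDecomposition {n : ℕ} (H : Graph n) {k : ℕ} (T : RootedTree k) : Set₁ where
  field
    Bag       : Fin k → Fin n → Set
    covers    : ∀ v → ∃[ x ] Bag x v
    edges     : ∀ u v → Adj H u v → ∃[ x ] (Bag x u × Bag x v)
    subtree   : ∀ v x y → Bag x v → Bag y v →
                ∃[ l ] Walk (Restrict (TAdj T) (λ z → Bag z v)) l x y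

open TreeDecomposition public

-- H is edge-maximal w.r.t. the decomposition: every bag induces a clique
EdgeMaximal : ∀ {n} {H : Graph n} {k} {T : RootedTree k} → TreeDecomposition H T → Set
EdgeMaximal {H = H} D = ∀ x u v → Bag D x u → Bag D x v → u ≢ v → Adj H u v

IsTopNode : ∀ {n} {H : Graph n} {k} {T : RootedTree k} → TreeDecomposition H T → Fin n → Fin k → Set
IsTopNode {T = T} D v x =
  Bag D x v × (∀ y → Bag D y v → ∀ dx dy → Depth T x dx → Depth T y dy → dx ≤ dy)

PrecT : ∀ {n} {H : Graph n} {k} {T : RootedTree k} → TreeDecomposition H T → Fin n → Fin n → Set
PrecT {T = T} D v w = ∃[ x ] ∃[ y ] (IsTopNode D v x × IsTopNode D w y × StrictAncestor T x y)

-- BFS layerings, represented by the layer index function (v ∈ L_i iff layer v ≡ i)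

record BFSLayering {n : ℕ} (H : Graph n) (L0 : Fin n → Set) : Set where
  field
    layer     : Fin n → ℕ
    layer0→L0 : ∀ v → layer v ≡ 0 → L0 v
    L0→layer0 : ∀ v → L0 v → layer v ≡ 0
    dist      : ∀ v → 1 ≤ layer v → DistTo H L0 v (layer v)

open BFSLayering public

module Submission where

-- Let v ≺_T w, with x = x_T(v) a strict ancestor of y = x_T(w), and let c be
-- the child of x on the tree path towards y.  The proof has three ingredients.
--   * Rooted trees: a strict ancestor is strictly shallower, so w ∉ B_x
--     (y is a shallowest bag of w); the subtree T_c below c is decidable, does
--     not contain the root, and the only tree edge leaving it ends at x.
--   * Separation: B_x separates T_c from the rest, i.e. a vertex with bags on
--     both sides lies in B_x, and hence every walk in H from a vertex with a
--     bag outside T_c to a vertex w ∉ B_x with a bag inside T_c meets B_x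
--     strictly before its end.
--   * BFS layers: every w is reached from L_0 by a walk of length layer(w),
--     walks from L_0 bound layers from above, and vertices of a common bag
--     (a clique, by edge-maximality) have layers differing by at most one.
-- A shortest walk from L_0 = B_r to w meets some s ∈ B_x after p < layer(w)
-- steps, so layer(v) ≤ layer(s) + 1 ≤ p + 1 ≤ layer(w).

open import Defs hiding (sym)
open import Data.Nat using (ℕ; zero; suc; _+_; _∸_; _≤_; _<_; z≤n; s≤s; _≤?_)
open import Data.Nat.Properties
  using (≤-refl; ≤-trans; ≤-<-trans; <⇒≤; <⇒≱; ≮⇒≥; ≰⇒>; ≤-pred; n≤1+n; n<1⇒n≡0; m∸n+n≡m; ∸-monoʳ-<; anyUpTo?)
open import Data.Nat.Induction using (<-rec)
open import Data.Fin using (Fin)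
open import Data.Fin.Properties using () renaming (_≟_ to _≟F_)
open import Data.Product using (∃-syntax; _×_; _,_; proj₁; proj₂)
open import Data.Sum using (inj₁; inj₂)
open import Data.Empty using (⊥-elim)
open import Relation.Nullary using (¬_; yes; no)
open import Relation.Nullary.Decidable using (map′)
open import Relation.Unary using (Decidable)
open import Relation.Binary.PropositionalEquality using (_≡_; _≢_; refl; sym; trans; cong; subst)

Least : (ℕ → Set) → ℕ → Set
Least P m = P m × (∀ m' → m' < m → ¬ P m')

least : {P : ℕ → Set} → Decidable P → ∀ n → P n → ∃[ m ] Least P m
least {P} P? = <-rec (λ n → P n → ∃[ m ] Least P m) step
  where
  step : ∀ n → (∀ {m} → m < n → P m → ∃[ m' ] Least P m') → P n → ∃[ m ] Least P m
  step n smaller pn with anyUpTo? P? n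
  ... | yes (m , m<n , pm) = smaller m<n pm
  ... | no none = n , pn , λ m m<n pm → none (m , m<n , pm)

iter-+ : {A : Set} (f : A → A) → ∀ m n a → iter f (m + n) a ≡ iter f m (iter f n a)
iter-+ f zero    n a = refl
iter-+ f (suc m) n a = cong f (iter-+ f m n a)

iter-suc : {A : Set} (f : A → A) → ∀ m a → iter f (suc m) a ≡ iter f m (f a)
iter-suc f zero    a = refl
iter-suc f (suc m) a = cong f (iter-suc f m a)

snoc : ∀ {A : Set} {R : A → A → Set} {k a b c} → Walk R k a b → R b c → Walk R (suc k) a c
snoc nil        r = cons r nil
snoc (cons s w) r = cons s (snoc w r)

ancestor : ∀ {k} → RootedTree k → ℕ → Fin k → Fin k
ancestor T = iter (parent T)

InSubtree : ∀ {k} → RootedTree k → Fin k → Fin k → Set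
InSubtree T c z = ∃[ m ] ancestor T m z ≡ c

module _ {k} (T : RootedTree k) where
  open Relation.Binary.PropositionalEquality.≡-Reasoning

  ancestor-root : ∀ m → ancestor T m (root T) ≡ root T
  ancestor-root zero    = refl
  ancestor-root (suc m) = trans (cong (parent T) (ancestor-root m)) (parent-root T)

  ancestor-past-root : ∀ {x d m} → ancestor T d x ≡ root T → d ≤ m → ancestor T m x ≡ root T
  ancestor-past-root {x} {d} {m} hit d≤m = begin
    ancestor T m x                      ≡⟨ cong (λ e → ancestor T e x) (sym (m∸n+n≡m d≤m)) ⟩
    ancestor T (m ∸ d + d) x            ≡⟨ iter-+ (parent T) (m ∸ d) d x ⟩
    ancestor T (m ∸ d) (ancestor T d x) ≡⟨ cong (ancestor T (m ∸ d)) hit ⟩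
    ancestor T (m ∸ d) (root T)         ≡⟨ ancestor-root (m ∸ d) ⟩
    root T                              ∎

  depth-exists : ∀ x → ∃[ d ] Depth T x d
  depth-exists x = least (λ m → ancestor T m x ≟F root T) (proj₁ (reach-root T x)) (proj₂ (reach-root T x))

  depth-minimal : ∀ {x d m} → Depth T x d → ancestor T m x ≡ root T → d ≤ m
  depth-minimal (_ , minimal) hit = ≮⇒≥ (λ m<d → minimal _ m<d hit)

  depth-positive : ∀ {y d} → Depth T y d → y ≢ root T → 0 < d
  depth-positive {d = zero}  (hit , _) y≢root = ⊥-elim (y≢root hit)
  depth-positive {d = suc _} _         _      = s≤s z≤n

  ancestor-shallower : ∀ {x y j dx dy} → x ≢ y → ancestor T j y ≡ x →
                       Depth T x dx → Depth T y dy → dx < dy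
  ancestor-shallower {j = zero} x≢y y≡x _ _ = ⊥-elim (x≢y (sym y≡x))
  ancestor-shallower {x} {y} {j@(suc _)} {dx} {dy} x≢y yj≡x Dx Dy@(y-hit , _) with j ≤? dy
  ... | yes j≤dy = ≤-<-trans (depth-minimal Dx x-hit) (∸-monoʳ-< (s≤s z≤n) j≤dy)
    where
    x-hit : ancestor T (dy ∸ j) x ≡ root T
    x-hit = begin
      ancestor T (dy ∸ j) x                ≡⟨ cong (ancestor T (dy ∸ j)) (sym yj≡x) ⟩
      ancestor T (dy ∸ j) (ancestor T j y) ≡⟨ sym (iter-+ (parent T) (dy ∸ j) j y) ⟩
      ancestor T (dy ∸ j + j) y            ≡⟨ cong (λ e → ancestor T e y) (m∸n+n≡m j≤dy) ⟩
      ancestor T dy y                      ≡⟨ y-hit ⟩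
      root T                               ∎
  ... | no j≰dy = ≤-<-trans (depth-minimal {m = 0} Dx x≡root) (depth-positive Dy y≢root)
    where
    -- y reaches the root within j steps, so its j-th ancestor x is the root
    x≡root : x ≡ root T
    x≡root = trans (sym yj≡x) (ancestor-past-root y-hit (<⇒≤ (≰⇒> j≰dy)))
    y≢root : y ≢ root T
    y≢root y≡root = x≢y (trans x≡root (sym y≡root))

  child-towards : ∀ {x y j} → x ≢ y → ancestor T j y ≡ x →
                  ∃[ c ] (parent T c ≡ x × c ≢ root T × InSubtree T c y)
  child-towards {x} {y} {j} x≢y yj≡x with least (λ m → ancestor T m y ≟F x) j yj≡x
  ... | zero  , y≡x , _       = ⊥-elim (x≢y (sym y≡x))
  ... | suc m , c↑≡x , minimal = ancestor T m y , c↑≡x , c≢root , m , refl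
    where
    c≢root : ancestor T m y ≢ root T
    c≢root c≡root = minimal m ≤-refl (begin
      ancestor T m y            ≡⟨ c≡root ⟩
      root T                    ≡⟨ sym (parent-root T) ⟩
      parent T (root T)         ≡⟨ cong (parent T) (sym c≡root) ⟩
      parent T (ancestor T m y) ≡⟨ c↑≡x ⟩
      x                         ∎)

  module Subtree (c : Fin k) (c≢root : c ≢ root T) where

    -- Membership in the subtree is decidable: a node reaching c does so
    -- before it reaches the root.
    inSubtree? : Decidable (InSubtree T c)
    inSubtree? z with reach-root T z
    ... | J , z-hit =
      map′ (λ (m , _ , e) → m , e) (λ (m , e) → m , bounded m e , e)
           (anyUpTo? (λ m → ancestor T m z ≟F c) (suc J))
      where
      bounded : ∀ m → ancestor T m z ≡ c → m < suc J
      bounded m e = s≤s (≮⇒≥ (λ J<m → c≢root (trans (sym e) (ancestor-past-root z-hit (<⇒≤ J<m)))))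

    root-outside : ¬ InSubtree T c (root T)
    root-outside (m , e) = c≢root (trans (sym e) (ancestor-root m))

    leave-subtree : ∀ {z z'} → TAdj T z z' → InSubtree T c z → ¬ InSubtree T c z' → z' ≡ parent T c
    leave-subtree (inj₁ (_ , refl)) (zero  , z≡c) _       = cong (parent T) z≡c
    leave-subtree {z} (inj₁ (_ , refl)) (suc m , e) outside =
      ⊥-elim (outside (m , trans (sym (iter-suc (parent T) m z)) e))
    leave-subtree {z' = z'} (inj₂ (_ , refl)) (m , e) outside =
      ⊥-elim (outside (suc m , trans (iter-suc (parent T) m z') e))

-- A shallowest bag of w lies below every strict ancestor bag, which therefore
-- misses w.
top-node-not-above : ∀ {n} {H : Graph n} {k} {T : RootedTree k} (D : TreeDecomposition H T) →
                     ∀ {w x y j} → IsTopNode D w y → x ≢ y → ancestor T j y ≡ x → ¬ Bag D x w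
top-node-not-above {T = T} D {x = x} {y} {j} (_ , shallowest) x≢y yj≡x w∈Bx
  with depth-exists T x | depth-exists T y
... | dx , Dx | dy , Dy = <⇒≱ (ancestor-shallower T {j = j} x≢y yj≡x Dx Dy) (shallowest x w∈Bx dy dx Dy Dx)

module Separation {n} (H : Graph n) {k} (T : RootedTree k) (D : TreeDecomposition H T)
                  (c x : Fin k) (c↑≡x : parent T c ≡ x) (c≢root : c ≢ root T) where
  open Subtree T c c≢root

  BagInside BagOutside : Fin n → Set
  BagInside  t = ∃[ z ] (InSubtree T c z × Bag D z t)
  BagOutside t = ∃[ z ] (¬ InSubtree T c z × Bag D z t)

  -- A vertex with bags on both sides lies in B_x: the connected set of its
  -- bags must use the tree edge leaving the subtree.
  boundary : ∀ {t} → BagInside t → BagOutside t → Bag D x t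
  boundary {t} (z , inside , t∈z) (z' , outside , t∈z') =
    cross (proj₂ (subtree D t z z' t∈z t∈z')) inside outside
    where
    cross : ∀ {l z₁ z₂} → Walk (Restrict (TAdj T) (λ z → Bag D z t)) l z₁ z₂ →
            InSubtree T c z₁ → ¬ InSubtree T c z₂ → Bag D x t
    cross nil inside outside = ⊥-elim (outside inside)
    cross (cons {b = z} (edge , _ , t∈z) rest) inside outside with inSubtree? z
    ... | yes inside' = cross rest inside' outside
    ... | no outside' = subst (λ q → Bag D q t) (trans (leave-subtree edge inside outside') c↑≡x) t∈z

  separation : ∀ {i a w} → Walk (Adj H) i a w → BagOutside a → BagInside w → ¬ Bag D x w →
               ∃[ s ] (Bag D x s × ∃[ p ] (p < i × Walk (Adj H) p a s))
  separation nil a-out w-in w∉Bx = ⊥-elim (w∉Bx (boundary w-in a-out))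
  separation {a = a} (cons {b = b} e rest) a-out w-in w∉Bx with edges D a b e
  ... | z , a∈z , b∈z with inSubtree? z
  ...   | yes inside = a , boundary (z , inside , a∈z) a-out , 0 , s≤s z≤n , nil
  ...   | no outside with separation rest (z , outside , b∈z) w-in w∉Bx
  ...     | s , s∈Bx , p , p<i , W = s , s∈Bx , suc p , s≤s p<i , cons e W

module Layers {n} (H : Graph n) {L0 : Fin n → Set} (L : BFSLayering H L0) where

  bfs-walk : ∀ w → ∃[ u ] (L0 u × Walk (Adj H) (layer L w) u w)
  bfs-walk w with 1 ≤? layer L w
  ... | yes 1≤ = proj₁ (dist L w 1≤)
  ... | no 1≰ = w , layer0→L0 L w layer≡0 , subst (λ i → Walk (Adj H) i w w) (sym layer≡0) nil
    where
    layer≡0 : layer L w ≡ 0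
    layer≡0 = n<1⇒n≡0 (≰⇒> 1≰)

  layer≤walk : ∀ {a s p} → L0 a → Walk (Adj H) p a s → layer L s ≤ p
  layer≤walk {a} {s} {p} a∈L0 W with 1 ≤? layer L s
  ... | yes 1≤ = proj₂ (dist L s 1≤) p a a∈L0 W
  ... | no 1≰ = ≤-trans (≤-pred (≰⇒> 1≰)) z≤n

  layer-adjacent : ∀ {a b} → Adj H a b → layer L a ≤ suc (layer L b)
  layer-adjacent {b = b} e with bfs-walk b
  ... | u , u∈L0 , W = layer≤walk u∈L0 (snoc W (Graph.sym H e))

  -- In an edge-maximal decomposition, vertices of a common bag are equal or
  -- adjacent, so their layers differ by at most one.
  layer-same-bag : ∀ {k} {T : RootedTree k} (D : TreeDecomposition H T) → EdgeMaximal D →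
                   ∀ {x v s} → Bag D x v → Bag D x s → layer L v ≤ suc (layer L s)
  layer-same-bag _ clique {x} {v} {s} v∈Bx s∈Bx with v ≟F s
  ... | yes refl = n≤1+n _
  ... | no v≢s = layer-adjacent (clique x v s v∈Bx s∈Bx v≢s)

mainTheorem9 : ∀ {n k} (H : Graph n) (T : RootedTree k) (D : TreeDecomposition H T) →
    Connected H → EdgeMaximal D →
    (L : BFSLayering H (Bag D (root T))) →
    ∀ v w → PrecT D v w → layer L v ≤ layer L w
mainTheorem9 H T D _ clique L v w (x , y , (v∈Bx , _) , w-top@(w∈By , _) , (x≢y , j , yj≡x))
  with child-towards T {j = j} x≢y yj≡x
... | c , c↑≡x , c≢root , y-below-c with Layers.bfs-walk H L w
...   | u , u∈Br , W with Separation.separation H T D c x c↑≡x c≢root W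
                            (root T , Subtree.root-outside T c c≢root , u∈Br)
                            (y , y-below-c , w∈By)
                            (top-node-not-above D {j = j} w-top x≢y yj≡x)
...     | s , s∈Bx , p , p<layer-w , Ws = begin
  layer L v        ≤⟨ Layers.layer-same-bag H L D clique v∈Bx s∈Bx ⟩
  suc (layer L s)  ≤⟨ s≤s (Layers.layer≤walk H L u∈Br Ws) ⟩
  suc p            ≤⟨ p<layer-w ⟩
  layer L w        ∎
  where open Data.Nat.Properties.≤-Reasoning
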